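{- Let $(g,f_1,f_2)$ be a Sprugnoli array and $h(x)=\sum_{n\ge0}a_nx^n$ any power series, with even and odd bisections $h^e(x)=\sum_{n\ge0}a_{2n}x^n$ and $h^o(x)=\sum_{n\ge0}a_{2n+1}x^n$. Then $$(g,f_1,f_2)\cdot h(x)=g(x)\,h^e(xf_2(x))+g(x)f_1(x)\,h^o(xf_2(x)).$$
   Context: All power series are formal power series over a field $\mathbb{K}$ of characteristic $0$. $\mathcal{F}_r$ denotes the set of power series $\sum_{n\ge r}a_nx^n$ with $a_r\ne0$. A Sprugnoli array is a triple $(g,f_1,f_2)$ with $g\in\mathcal{F}_0$, $f_1\in\mathcal{F}_1$, $f_2\in\mathcal{F}_1$ and $f_2$ odd (only odd powers of $x$); its matrix is the lower-triangular matrix $(t_{n,k})_{n,k\ge0}$ with $t_{n,k}=[x^n]\,g(x)f_1(x)^{k\bmod 2}(xf_2(x))^{\lfloor k/2\rfloor}$. For a power series $h=\sum_n a_nx^n$, $(g,f_1,f_2)\cdot h$ denotes the power series $\sum_n\left(\sum_k t_{n,k}a_k\right)x^n$. -}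

module Defs where

open import Level using (Level; suc; _⊔_)
open import Data.Nat as ℕ using (ℕ; zero; _<_)
open import Data.Nat.DivMod using (_/_; _%_)
open import Data.Product using (Σ)
open import Relation.Nullary using (¬_)
open import Relation.Binary.PropositionalEquality using (_≡_)
open import Algebra.Bundles using (CommutativeRing)

record Field (c ℓ : Level) : Set (suc (c ⊔ ℓ)) where
  field
    commutativeRing : CommutativeRing c ℓ
  open CommutativeRing commutativeRing public
  field
    0≉1     : ¬ (0# ≈ 1#)
    inverse : ∀ x → ¬ (x ≈ 0#) → Σ Carrier (λ y → x * y ≈ 1#)

  ntimes : ℕ → Carrier
  ntimes zero      = 0#
  ntimes (ℕ.suc n) = 1# + ntimes n

CharZero : ∀ {c ℓ} → Field c ℓ → Set ℓ
CharZero F = ∀ n → ntimes n ≈ 0# → n ≡ 0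
  where open Field F

module PowerSeries {c ℓ} (F : Field c ℓ) where
  open Field F

  PS : Set c
  PS = ℕ → Carrier

  sumTo : ℕ → (ℕ → Carrier) → Carrier
  sumTo zero      a = 0#
  sumTo (ℕ.suc n) a = sumTo n a + a n

  _≋_ : PS → PS → Set ℓ
  f ≋ g = ∀ n → f n ≈ g n

  -- membership in 𝓕_r : order exactly r
  InF : ℕ → PS → Set ℓ
  InF r f = (∀ n → n < r → f n ≈ 0#) × ¬ (f r ≈ 0#)
    where open import Data.Product using (_×_)

  IsOdd : PS → Set ℓ
  IsOdd f = ∀ n → f (2 ℕ.* n) ≈ 0#

  oneS : PS
  oneS zero      = 1#
  oneS (ℕ.suc n) = 0#

  X : PS
  X 1 = 1#
  X _ = 0#

  _⊕_ : PS → PS → PS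
  (f ⊕ g) n = f n + g n

  _⊛_ : PS → PS → PS
  (f ⊛ g) n = sumTo (ℕ.suc n) (λ i → f i * g (n ℕ.∸ i))

  _^^_ : PS → ℕ → PS
  f ^^ zero      = oneS
  f ^^ ℕ.suc k   = f ⊛ (f ^^ k)

  -- composition h(u(x)) = Σ_k h_k u(x)^k ; for u with u 0 = 0 (the only
  -- case used) u^k has order ≥ k, so [x^n] only involves k ≤ n.
  compose : PS → PS → PS
  compose h u n = sumTo (ℕ.suc n) (λ k → h k * (u ^^ k) n)

  evenPart : PS → PS
  evenPart h n = h (2 ℕ.* n)

  oddPart : PS → PS
  oddPart h n = h (ℕ.suc (2 ℕ.* n))

  sprugnoliEntry : PS → PS → PS → ℕ → ℕ → Carrier
  sprugnoliEntry g f₁ f₂ n k = (g ⊛ ((f₁ ^^ (k % 2)) ⊛ ((X ⊛ f₂) ^^ (k / 2)))) n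

  -- (g,f1,f2) · h : [x^n] = Σ_k t n k a_k ; the matrix is lower triangular
  -- (t n k = 0 for k > n), so the sum is over k ≤ n.
  act : PS → PS → PS → PS → PS
  act g f₁ f₂ h n = sumTo (ℕ.suc n) (λ k → sprugnoliEntry g f₁ f₂ n k * h k)

-- Column k of the array is g f₁^(k mod 2) P^⌊k/2⌋ with P = x f₂, and since
-- f₁(0) = f₂(0) = 0 this column has order at least k. So the n-th coefficient
-- of (g,f₁,f₂)·h may be summed over k < 2(n+1); grouping k = 2j and k = 2j+1
-- gives Σ_j a_{2j} [xⁿ] g P^j + Σ_j a_{2j+1} [xⁿ] g f₁ P^j, and each of these
-- sums is the n-th coefficient of a product G·hᵉ(P) resp. G·hᵒ(P), because
-- multiplying by G commutes with substituting P termwise.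
module Submission where

open import Defs
open import Data.Nat as ℕ using (ℕ; zero; suc; _<_; _≤_; _≤′_; s≤s; _∸_)
import Data.Nat.Properties as ℕₚ
open import Data.Nat.DivMod
open import Data.Nat.Divisibility using (divides-refl)
open import Data.Product using (proj₁)
open import Relation.Nullary using (yes; no)
open import Relation.Binary.PropositionalEquality as ≡ using (_≡_)
import Relation.Binary.Reasoning.Setoid as SetoidReasoning
import Algebra.Properties.CommutativeSemigroup as CommutativeSemigroupProperties
open import Function using (_∘_)

even%2≡0 : ∀ j → 2 ℕ.* j % 2 ≡ 0
even%2≡0 j = ≡.trans (≡.cong (_% 2) (ℕₚ.*-comm 2 j)) (m*n%n≡0 j 2)

even/2≡half : ∀ j → 2 ℕ.* j / 2 ≡ j
even/2≡half j = ≡.trans (≡.cong (_/ 2) (ℕₚ.*-comm 2 j)) (m*n/n≡m j 2)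

odd%2≡1 : ∀ j → suc (2 ℕ.* j) % 2 ≡ 1
odd%2≡1 j = ≡.trans (≡.cong (_% 2) (≡.cong suc (ℕₚ.*-comm 2 j))) ([m+kn]%n≡m%n 1 j 2)

odd/2≡half : ∀ j → suc (2 ℕ.* j) / 2 ≡ j
odd/2≡half j = ≡.trans (≡.cong (_/ 2) (≡.cong suc (ℕₚ.*-comm 2 j)))
  (≡.trans (+-distrib-/-∣ʳ 1 {d = 2} (divides-refl j)) (m*n/n≡m j 2))

module _ {c ℓ} (F : Field c ℓ) where
  open Field F
  open PowerSeries F
  open SetoidReasoning setoid
  open CommutativeSemigroupProperties +-commutativeSemigroup using (interchange)
  open CommutativeSemigroupProperties *-commutativeSemigroup using (x∙yz≈y∙xz)

  sumTo-cong : ∀ n {a b : ℕ → Carrier} → (∀ i → a i ≈ b i) → sumTo n a ≈ sumTo n b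
  sumTo-cong zero    a≈b = refl
  sumTo-cong (suc n) a≈b = +-cong (sumTo-cong n a≈b) (a≈b n)

  sumTo-zero : ∀ n {a : ℕ → Carrier} → (∀ i → i < n → a i ≈ 0#) → sumTo n a ≈ 0#
  sumTo-zero zero    a≈0 = refl
  sumTo-zero (suc n) a≈0 =
    trans (+-cong (sumTo-zero n (λ i i<n → a≈0 i (ℕₚ.m<n⇒m<1+n i<n))) (a≈0 n (ℕₚ.n<1+n n)))
          (+-identityʳ 0#)

  sumTo-+ : ∀ n (a b : ℕ → Carrier) → sumTo n (λ i → a i + b i) ≈ sumTo n a + sumTo n b
  sumTo-+ zero    a b = sym (+-identityʳ 0#)
  sumTo-+ (suc n) a b = trans (+-congʳ (sumTo-+ n a b)) (interchange _ _ _ _)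

  *-distribˡ-sumTo : ∀ n x (a : ℕ → Carrier) → x * sumTo n a ≈ sumTo n (λ i → x * a i)
  *-distribˡ-sumTo zero    x a = zeroʳ x
  *-distribˡ-sumTo (suc n) x a = trans (distribˡ x _ _) (+-congʳ (*-distribˡ-sumTo n x a))

  *-distribʳ-sumTo : ∀ n x (a : ℕ → Carrier) → sumTo n a * x ≈ sumTo n (λ i → a i * x)
  *-distribʳ-sumTo zero    x a = zeroˡ x
  *-distribʳ-sumTo (suc n) x a = trans (distribʳ x _ _) (+-congʳ (*-distribʳ-sumTo n x a))

  sumTo-suc-head : ∀ n (a : ℕ → Carrier) → sumTo (suc n) a ≈ a 0 + sumTo n (λ i → a (suc i))
  sumTo-suc-head zero    a = trans (+-identityˡ _) (sym (+-identityʳ _))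
  sumTo-suc-head (suc n) a = trans (+-congʳ (sumTo-suc-head n a)) (+-assoc _ _ _)

  sumTo-extend : ∀ {m n} (a : ℕ → Carrier) → m ≤ n → (∀ i → m ≤ i → a i ≈ 0#) →
                 sumTo m a ≈ sumTo n a
  sumTo-extend {m} a m≤n a≈0 = extend (ℕₚ.≤⇒≤′ m≤n)
    where
    extend : ∀ {n} → m ≤′ n → sumTo m a ≈ sumTo n a
    extend ℕ.≤′-refl = refl
    extend {suc n} (ℕ.≤′-step m≤′n) =
      trans (sym (+-identityʳ _)) (+-cong (extend m≤′n) (sym (a≈0 n (ℕₚ.≤′⇒≤ m≤′n))))

  sumTo-swap : ∀ n m (G : ℕ → ℕ → Carrier) →
    sumTo n (λ i → sumTo m (λ j → G i j)) ≈ sumTo m (λ j → sumTo n (λ i → G i j))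
  sumTo-swap zero    m G = sym (sumTo-zero m (λ _ _ → refl))
  sumTo-swap (suc n) m G = trans (+-congʳ (sumTo-swap n m G)) (sym (sumTo-+ m _ _))

  sumTo-pairs : ∀ n (a : ℕ → Carrier) →
    sumTo (2 ℕ.* n) a ≈ sumTo n (λ j → a (2 ℕ.* j) + a (suc (2 ℕ.* j)))
  sumTo-pairs zero    a = refl
  sumTo-pairs (suc n) a = ≡.subst (λ m → sumTo m a ≈ sumTo (suc n) pair) (≡.sym (ℕₚ.*-suc 2 n))
    (trans (+-assoc _ _ _) (+-congʳ (sumTo-pairs n a)))
    where
    pair : ℕ → Carrier
    pair j = a (2 ℕ.* j) + a (suc (2 ℕ.* j))

  antidiagonal : ℕ → (ℕ → ℕ → Carrier) → Carrier
  antidiagonal n G = sumTo (suc n) (λ i → G i (n ∸ i))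

  antidiagonal-cong : ∀ n {G H : ℕ → ℕ → Carrier} → (∀ i j → G i j ≈ H i j) →
                      antidiagonal n G ≈ antidiagonal n H
  antidiagonal-cong n G≈H = sumTo-cong (suc n) (λ i → G≈H i (n ∸ i))

  antidiagonal-+ : ∀ n G H →
    antidiagonal n (λ i j → G i j + H i j) ≈ antidiagonal n G + antidiagonal n H
  antidiagonal-+ n G H = sumTo-+ (suc n) _ _

  antidiagonal-suc : ∀ n G →
    antidiagonal (suc n) G ≈ G 0 (suc n) + antidiagonal n (λ i j → G (suc i) j)
  antidiagonal-suc n G = sumTo-suc-head (suc n) _

  antidiagonal-assoc : ∀ n (G : ℕ → ℕ → ℕ → Carrier) →
    antidiagonal n (λ i j → antidiagonal j (λ l r → G i l r)) ≈
    antidiagonal n (λ m r → antidiagonal m (λ i l → G i l r))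
  antidiagonal-assoc zero    G = refl
  antidiagonal-assoc (suc n) G = begin
      antidiagonal (suc n) (λ i j → antidiagonal j (λ l r → G i l r))
    ≈⟨ antidiagonal-suc n (λ i j → antidiagonal j (G i)) ⟩
      antidiagonal (suc n) (G 0) + antidiagonal n (λ i j → antidiagonal j (G (suc i)))
    ≈⟨ +-cong (antidiagonal-suc n (G 0)) (antidiagonal-assoc n (λ i → G (suc i))) ⟩
      (G 0 0 (suc n) + antidiagonal n (λ l → G 0 (suc l)))
        + antidiagonal n (λ m r → antidiagonal m (λ i l → G (suc i) l r))
    ≈⟨ +-assoc _ _ _ ⟩
      G 0 0 (suc n) + (antidiagonal n (λ l → G 0 (suc l))
        + antidiagonal n (λ m r → antidiagonal m (λ i l → G (suc i) l r)))
    ≈⟨ +-cong (sym (+-identityˡ _))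
              (sym (antidiagonal-+ n (G 0 ∘ suc) (λ m r → antidiagonal m (λ i l → G (suc i) l r)))) ⟩
      (0# + G 0 0 (suc n))
        + antidiagonal n (λ m r → G 0 (suc m) r + antidiagonal m (λ i l → G (suc i) l r))
    ≈⟨ +-congˡ (antidiagonal-cong n (λ m r → sym (antidiagonal-suc m (λ i l → G i l r)))) ⟩
      (0# + G 0 0 (suc n)) + antidiagonal n (λ m r → antidiagonal (suc m) (λ i l → G i l r))
    ≈⟨ sym (antidiagonal-suc n (λ m r → antidiagonal m (λ i l → G i l r))) ⟩
      antidiagonal (suc n) (λ m r → antidiagonal m (λ i l → G i l r))
    ∎

  ⊛-congˡ : ∀ a {b b′} → b ≋ b′ → (a ⊛ b) ≋ (a ⊛ b′)
  ⊛-congˡ a b≋b′ n = sumTo-cong (suc n) (λ i → *-congˡ (b≋b′ (n ∸ i)))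

  ⊛-congʳ : ∀ {a a′} b → a ≋ a′ → (a ⊛ b) ≋ (a′ ⊛ b)
  ⊛-congʳ b a≋a′ n = sumTo-cong (suc n) (λ i → *-congʳ (a≋a′ i))

  ⊛-assoc : ∀ a b d → (a ⊛ (b ⊛ d)) ≋ ((a ⊛ b) ⊛ d)
  ⊛-assoc a b d n = begin
      antidiagonal n (λ i j → a i * antidiagonal j (λ l r → b l * d r))
    ≈⟨ antidiagonal-cong n (λ i j → *-distribˡ-sumTo (suc j) (a i) (λ l → b l * d (j ∸ l))) ⟩
      antidiagonal n (λ i j → antidiagonal j (λ l r → a i * (b l * d r)))
    ≈⟨ antidiagonal-assoc n (λ i l r → a i * (b l * d r)) ⟩
      antidiagonal n (λ m r → antidiagonal m (λ i l → a i * (b l * d r)))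
    ≈⟨ antidiagonal-cong n (λ m r → antidiagonal-cong m (λ i l → sym (*-assoc (a i) (b l) (d r)))) ⟩
      antidiagonal n (λ m r → antidiagonal m (λ i l → (a i * b l) * d r))
    ≈⟨ antidiagonal-cong n (λ m r → sym (*-distribʳ-sumTo (suc m) (d r) (λ i → a i * b (m ∸ i)))) ⟩
      antidiagonal n (λ m r → antidiagonal m (λ i l → a i * b l) * d r)
    ∎

  ⊛-identityˡ : ∀ a → (oneS ⊛ a) ≋ a
  ⊛-identityˡ a n = begin
      sumTo (suc n) (λ i → oneS i * a (n ∸ i))
    ≈⟨ sumTo-suc-head n _ ⟩
      1# * a n + sumTo n (λ i → 0# * a (n ∸ suc i))
    ≈⟨ +-cong (*-identityˡ _) (sumTo-zero n (λ i _ → zeroˡ _)) ⟩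
      a n + 0#
    ≈⟨ +-identityʳ _ ⟩
      a n
    ∎

  oneS-∸-< : ∀ {n i} → i < n → oneS (n ∸ i) ≈ 0#
  oneS-∸-< {suc n} {zero}  _         = refl
  oneS-∸-< {suc n} {suc i} (s≤s i<n) = oneS-∸-< i<n

  ⊛-identityʳ : ∀ a → (a ⊛ oneS) ≋ a
  ⊛-identityʳ a n = begin
      sumTo n (λ i → a i * oneS (n ∸ i)) + a n * oneS (n ∸ n)
    ≈⟨ +-cong (sumTo-zero n (λ i i<n → trans (*-congˡ (oneS-∸-< i<n)) (zeroʳ _)))
              (trans (*-congˡ (reflexive (≡.cong oneS (ℕₚ.n∸n≡0 n)))) (*-identityʳ _)) ⟩
      0# + a n
    ≈⟨ +-identityˡ _ ⟩
      a n
    ∎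

  OrderAtLeast : ℕ → PS → Set ℓ
  OrderAtLeast r u = ∀ n → n < r → u n ≈ 0#

  X-order : OrderAtLeast 1 X
  X-order zero _ = refl
  X-order (suc _) (s≤s ())

  ⊛-order : ∀ {r s a b} → OrderAtLeast r a → OrderAtLeast s b → OrderAtLeast (r ℕ.+ s) (a ⊛ b)
  ⊛-order {r} {s} {a} {b} ord-a ord-b n n<r+s = sumTo-zero (suc n) term-vanishes
    where
    term-vanishes : ∀ i → i < suc n → a i * b (n ∸ i) ≈ 0#
    term-vanishes i i<1+n with i ℕₚ.<? r
    ... | yes i<r = trans (*-congʳ (ord-a i i<r)) (zeroˡ _)
    ... | no i≮r  = trans (*-congˡ (ord-b (n ∸ i) n∸i<s)) (zeroʳ _)
      where
      n∸i<s : n ∸ i < s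
      n∸i<s = ℕₚ.<-≤-trans (ℕₚ.∸-monoˡ-< n<r+s (ℕ.s≤s⁻¹ i<1+n))
                (ℕₚ.≤-trans (ℕₚ.∸-monoʳ-≤ (r ℕ.+ s) (ℕₚ.≮⇒≥ i≮r)) (ℕₚ.≤-reflexive (ℕₚ.m+n∸m≡n r s)))

  ^^-order : ∀ {s u} k → OrderAtLeast s u → OrderAtLeast (k ℕ.* s) (u ^^ k)
  ^^-order zero    ord-u n ()
  ^^-order (suc k) ord-u = ⊛-order ord-u (^^-order k ord-u)

  ⊛-compose : ∀ a b {u} → OrderAtLeast 1 u → ∀ n →
    (a ⊛ compose b u) n ≈ sumTo (suc n) (λ j → b j * (a ⊛ (u ^^ j)) n)
  ⊛-compose a b {u} ord-u n = begin
      sumTo (suc n) (λ i → a i * sumTo (suc (n ∸ i)) (λ j → b j * (u ^^ j) (n ∸ i)))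
    ≈⟨ sumTo-cong (suc n) (λ i → *-congˡ (extend-inner i)) ⟩
      sumTo (suc n) (λ i → a i * sumTo (suc n) (λ j → b j * (u ^^ j) (n ∸ i)))
    ≈⟨ sumTo-cong (suc n) (λ i → *-distribˡ-sumTo (suc n) (a i) _) ⟩
      sumTo (suc n) (λ i → sumTo (suc n) (λ j → a i * (b j * (u ^^ j) (n ∸ i))))
    ≈⟨ sumTo-swap (suc n) (suc n) _ ⟩
      sumTo (suc n) (λ j → sumTo (suc n) (λ i → a i * (b j * (u ^^ j) (n ∸ i))))
    ≈⟨ sumTo-cong (suc n) (λ j → sumTo-cong (suc n) (λ i → x∙yz≈y∙xz (a i) (b j) _)) ⟩
      sumTo (suc n) (λ j → sumTo (suc n) (λ i → b j * (a i * (u ^^ j) (n ∸ i))))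
    ≈⟨ sumTo-cong (suc n) (λ j → sym (*-distribˡ-sumTo (suc n) (b j) _)) ⟩
      sumTo (suc n) (λ j → b j * (a ⊛ (u ^^ j)) n)
    ∎
    where
    extend-inner : ∀ i → sumTo (suc (n ∸ i)) (λ j → b j * (u ^^ j) (n ∸ i))
                       ≈ sumTo (suc n) (λ j → b j * (u ^^ j) (n ∸ i))
    extend-inner i = sumTo-extend _ (s≤s (ℕₚ.m∸n≤m n i)) (λ j n∸i<j →
      trans (*-congˡ (^^-order j ord-u (n ∸ i) (≡.subst (n ∸ i <_) (≡.sym (ℕₚ.*-identityʳ j)) n∸i<j)))
            (zeroʳ _))

  module _ (g f₁ f₂ : PS) where

    P : PS
    P = X ⊛ f₂

    sprugnoliEntry-even : ∀ n j → sprugnoliEntry g f₁ f₂ n (2 ℕ.* j) ≈ (g ⊛ (P ^^ j)) n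
    sprugnoliEntry-even n j = begin
      (g ⊛ ((f₁ ^^ (2 ℕ.* j % 2)) ⊛ (P ^^ (2 ℕ.* j / 2)))) n
        ≡⟨ ≡.cong₂ (λ e q → (g ⊛ ((f₁ ^^ e) ⊛ (P ^^ q))) n) (even%2≡0 j) (even/2≡half j) ⟩
      (g ⊛ (oneS ⊛ (P ^^ j))) n
        ≈⟨ ⊛-congˡ g (⊛-identityˡ (P ^^ j)) n ⟩
      (g ⊛ (P ^^ j)) n
        ∎

    sprugnoliEntry-odd : ∀ n j → sprugnoliEntry g f₁ f₂ n (suc (2 ℕ.* j)) ≈ ((g ⊛ f₁) ⊛ (P ^^ j)) n
    sprugnoliEntry-odd n j = begin
      (g ⊛ ((f₁ ^^ (suc (2 ℕ.* j) % 2)) ⊛ (P ^^ (suc (2 ℕ.* j) / 2)))) n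
        ≡⟨ ≡.cong₂ (λ e q → (g ⊛ ((f₁ ^^ e) ⊛ (P ^^ q))) n) (odd%2≡1 j) (odd/2≡half j) ⟩
      (g ⊛ ((f₁ ⊛ oneS) ⊛ (P ^^ j))) n
        ≈⟨ ⊛-congˡ g (⊛-congʳ (P ^^ j) (⊛-identityʳ f₁)) n ⟩
      (g ⊛ (f₁ ⊛ (P ^^ j))) n
        ≈⟨ ⊛-assoc g f₁ (P ^^ j) n ⟩
      ((g ⊛ f₁) ⊛ (P ^^ j)) n
        ∎

    module _ (ord-f₁ : OrderAtLeast 1 f₁) (ord-f₂ : OrderAtLeast 1 f₂) where

      sprugnoliEntry-lowerTriangular : ∀ {n k} → n < k → sprugnoliEntry g f₁ f₂ n k ≈ 0#
      sprugnoliEntry-lowerTriangular {n} {k} = ⊛-order {0} (λ _ ()) column-order n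
        where
        column-order : OrderAtLeast k ((f₁ ^^ (k % 2)) ⊛ (P ^^ (k / 2)))
        -- orders (k % 2)·1 and ⌊k/2⌋·2 add up to k
        column-order = ≡.subst (λ t → OrderAtLeast t ((f₁ ^^ (k % 2)) ⊛ (P ^^ (k / 2))))
          (≡.trans (≡.cong (ℕ._+ (k / 2 ℕ.* 2)) (ℕₚ.*-identityʳ (k % 2))) (≡.sym (m≡m%n+[m/n]*n k 2)))
          (⊛-order (^^-order (k % 2) ord-f₁) (^^-order (k / 2) (⊛-order X-order ord-f₂)))

      act-bisection : ∀ h → act g f₁ f₂ h ≋
        ((g ⊛ compose (evenPart h) P) ⊕ ((g ⊛ f₁) ⊛ compose (oddPart h) P))
      act-bisection h n = begin
        sumTo (suc n) (λ k → t k * h k)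
          ≈⟨ sumTo-extend _ (ℕₚ.m≤m+n (suc n) _)
               (λ k n<k → trans (*-congʳ (sprugnoliEntry-lowerTriangular n<k)) (zeroˡ _)) ⟩
        sumTo (2 ℕ.* suc n) (λ k → t k * h k)
          ≈⟨ sumTo-pairs (suc n) _ ⟩
        sumTo (suc n) (λ j → t (2 ℕ.* j) * h (2 ℕ.* j) + t (suc (2 ℕ.* j)) * h (suc (2 ℕ.* j)))
          ≈⟨ sumTo-cong (suc n) (λ j → +-cong
               (trans (*-congʳ (sprugnoliEntry-even n j)) (*-comm _ _))
               (trans (*-congʳ (sprugnoliEntry-odd n j)) (*-comm _ _))) ⟩
        sumTo (suc n) (λ j → evenPart h j * (g ⊛ (P ^^ j)) n + oddPart h j * ((g ⊛ f₁) ⊛ (P ^^ j)) n)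
          ≈⟨ sumTo-+ (suc n) _ _ ⟩
        sumTo (suc n) (λ j → evenPart h j * (g ⊛ (P ^^ j)) n)
          + sumTo (suc n) (λ j → oddPart h j * ((g ⊛ f₁) ⊛ (P ^^ j)) n)
          ≈⟨ sym (+-cong (⊛-compose g (evenPart h) ord-P n) (⊛-compose (g ⊛ f₁) (oddPart h) ord-P n)) ⟩
        (g ⊛ compose (evenPart h) P) n + ((g ⊛ f₁) ⊛ compose (oddPart h) P) n
          ∎
        where
        t : ℕ → Carrier
        t = sprugnoliEntry g f₁ f₂ n
        ord-P : OrderAtLeast 1 P
        ord-P = ⊛-order {b = f₂} X-order (λ _ ())

-- Only f₁(0) = f₂(0) = 0 is used: g(0) ≠ 0, the nonvanishing leading
-- coefficients, oddness of f₂ and characteristic 0 play no role.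
mainTheorem3 : ∀ {c ℓ} (F : Field c ℓ) → CharZero F →
    let open PowerSeries F in
    (g f₁ f₂ h : PS) →
    InF 0 g → InF 1 f₁ → InF 1 f₂ → IsOdd f₂ →
    act g f₁ f₂ h ≋
    ((g ⊛ compose (evenPart h) (X ⊛ f₂))
    ⊕ ((g ⊛ f₁) ⊛ compose (oddPart h) (X ⊛ f₂)))
mainTheorem3 F _ g f₁ f₂ h _ f₁∈𝓕₁ f₂∈𝓕₁ _ =
  act-bisection F g f₁ f₂ (proj₁ f₁∈𝓕₁) (proj₁ f₂∈𝓕₁) h
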